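{- Let $\mathbf F_q$ be the finite field with $q$ elements and $m$ a positive integer. For $n\ge0$ let $T^{q,m}_n$ be the set of orbits of $GL_m(\mathbf F_q)$ acting on $(\mathbf F_q^m)^n$ by $g\cdot(x_1,\dots,x_n)=(g(x_1),\dots,g(x_n))$. Then $$\sum_{n=0}^\infty |T^{q,m}_n|\,t^n=\sum_{i=0}^m t^i\prod_{r=0}^i\frac1{1-q^rt}.$$ -}

module Defs where

open import Level using (Level; _⊔_)
open import Data.Nat using (ℕ; zero; suc; _∸_; _^_; _<ᵇ_; _≡ᵇ_)
import Data.Nat as ℕ
open import Data.Bool using (if_then_else_)
open import Data.Fin using (Fin; toℕ)
import Data.Fin as Fin
open import Data.List using (List; upTo; map; foldr)
open import Data.Nat.ListAction using (sum)
open import Data.Product using (Σ; ∃; _×_; _,_)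
open import Algebra.Bundles using (CommutativeRing)
open import Relation.Nullary using (¬_)
open import Relation.Binary using (Decidable)
open import Relation.Binary.PropositionalEquality using (_≡_)
open import Function.Bundles using (_⇔_)

-- A field: a commutative ring with 0 ≉ 1 in which every nonzero element
-- has a multiplicative inverse.  Equality is decidable (as it is for any
-- finite field; needed constructively).
record IsFieldOn {c ℓ : Level} (R : CommutativeRing c ℓ) : Set (c ⊔ ℓ) where
  open CommutativeRing R
  field
    0≉1     : ¬ (0# ≈ 1#)
    inverse : ∀ x → ¬ (x ≈ 0#) → ∃ λ y → x * y ≈ 1#
    _≟_     : Decidable _≈_

record HasCard {c ℓ : Level} (R : CommutativeRing c ℓ) (q : ℕ) : Set (c ⊔ ℓ) where
  open CommutativeRing R
  field
    enum       : Fin q → Carrier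
    enum-inj   : ∀ i j → enum i ≈ enum j → i ≡ j
    enum-surj  : ∀ x → ∃ λ i → enum i ≈ x

record FiniteField (c ℓ : Level) (q : ℕ) : Set (Level.suc (c ⊔ ℓ)) where
  field
    ring    : CommutativeRing c ℓ
    isField : IsFieldOn ring
    card    : HasCard ring q

module LinAlg {c ℓ : Level} (R : CommutativeRing c ℓ) where
  open CommutativeRing R

  Σᶠ : ∀ {k} → (Fin k → Carrier) → Carrier
  Σᶠ {zero}  f = 0#
  Σᶠ {suc k} f = f Fin.zero + Σᶠ (λ i → f (Fin.suc i))

  Vector : ℕ → Set c
  Vector m = Fin m → Carrier

  Matrix : ℕ → Set c
  Matrix m = Fin m → Fin m → Carrier

  _≈ᵛ_ : ∀ {m} → Vector m → Vector m → Set ℓ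
  u ≈ᵛ v = ∀ i → u i ≈ v i

  _⊗_ : ∀ {m} → Matrix m → Matrix m → Matrix m
  (A ⊗ B) i j = Σᶠ (λ k → A i k * B k j)

  I : ∀ {m} → Matrix m
  I i j = if toℕ i ≡ᵇ toℕ j then 1# else 0#

  _≈ᴹ_ : ∀ {m} → Matrix m → Matrix m → Set ℓ
  A ≈ᴹ B = ∀ i j → A i j ≈ B i j

  apply : ∀ {m} → Matrix m → Vector m → Vector m
  apply A x i = Σᶠ (λ k → A i k * x k)

  IsInvertible : ∀ {m} → Matrix m → Set (c ⊔ ℓ)
  IsInvertible A = ∃ λ B → ((A ⊗ B) ≈ᴹ I) × ((B ⊗ A) ≈ᴹ I)

  Tuple : ℕ → ℕ → Set c
  Tuple m n = Fin n → Vector m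

  _≈ᵗ_ : ∀ {m n} → Tuple m n → Tuple m n → Set ℓ
  x ≈ᵗ y = ∀ j → x j ≈ᵛ y j

  act : ∀ {m n} → Matrix m → Tuple m n → Tuple m n
  act g x j = apply g (x j)

  SameOrbit : ∀ {m n} → Tuple m n → Tuple m n → Set (c ⊔ ℓ)
  SameOrbit x y = ∃ λ g → IsInvertible g × (act g x ≈ᵗ y)

  -- The set of orbits T_n has exactly k elements: there is a surjection
  -- (R^m)^n → Fin k whose fibres are exactly the orbits.
  NumOrbits : (m n k : ℕ) → Set (c ⊔ ℓ)
  NumOrbits m n k =
    Σ (Tuple m n → Fin k) λ f →
      (∀ (o : Fin k) → ∃ λ x → f x ≡ o) ×
      (∀ x y → (f x ≡ f y) ⇔ SameOrbit x y)

Series : Set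
Series = ℕ → ℕ

_⊛_ : Series → Series → Series
(f ⊛ g) n = sum (map (λ k → f k ℕ.* g (n ∸ k)) (upTo (suc n)))

one : Series
one zero    = 1
one (suc _) = 0

-- 1/(1 - a t) = Σ_k a^k t^k
geomInv : ℕ → Series
geomInv a k = a ^ k

shift : ℕ → Series → Series
shift i f n = if n <ᵇ i then 0 else f (n ∸ i)

prodInv : ℕ → ℕ → Series
prodInv q i = foldr (λ r s → geomInv (q ^ r) ⊛ s) one (upTo (suc i))

rhsSeries : ℕ → ℕ → Series
rhsSeries q m n = sum (map (λ i → shift i (prodInv q i) n) (upTo (suc m)))

-- Every n-tuple of vectors is GL_m-equivalent to exactly one tuple in reduced echelon
-- form, read from the last vector to the first: each vector is either the next standard
-- basis vector e_i (a new pivot) or an arbitrary combination of the pivots e_0, …, e_{i-1}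
-- met so far.  Existence is Gaussian elimination by transvections that fix the span of the
-- earlier pivots; uniqueness holds because an automorphism carrying one echelon form to
-- another fixes its pivots, hence every column.  So |T_n| is the number of echelon forms of
-- rank at most m, and the number T(n, i) of those of rank i satisfies
-- T(n+1, i+1) = T(n, i) + q^(i+1) T(n, i+1), the recurrence of the coefficient of tⁿ in
-- tⁱ ∏_{r ≤ i} 1/(1 - qʳ t).
module Submission where

open import Defs
open import Level using (Level)
open import Data.Nat using (ℕ; _≥_)

module EchelonCount where

  open import Data.Nat using (zero; suc; _+_; _*_; _∸_; _^_; _<_; z≤n; s≤s)
  open import Data.Nat.Properties using (*-assoc; *-identityˡ; *-distribˡ-+; +-identityʳ; *-zeroʳ)
  open import Data.Nat.ListAction using (sum)
  open import Data.List using (List; []; _∷_; map; foldr; applyUpTo; upTo; [_])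
  open import Data.List.Properties using (map-cong; map-∘; map-upTo; foldr-++; upTo-∷ʳ)
  open import Data.Product using (Σ; _×_; _,_; proj₁; proj₂; uncurry)
  open import Data.Fin using (Fin)
  open import Data.Sum using (_⊎_; inj₁; inj₂)
  open import Data.Unit using (⊤)
  open import Data.Fin.Properties using (*↔×; +↔⊎; 0↔⊥; 1↔⊤)
  open import Data.Vec as Vec using (Vec; uncons)
  open import Function.Bundles using (_↔_; mk↔ₛ′)
  open import Function.Properties.Inverse using (↔-refl; ↔-sym; ↔-trans)
  open import Function.Related.Propositional using (module EquationalReasoning)
  open import Data.Product.Function.NonDependent.Propositional using (_×-↔_)
  open import Data.Sum.Function.Propositional using (_⊎-↔_)
  open import Function using (_∘_)
  open import Data.Nat.Tactic.RingSolver using (solve-∀)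
  open import Relation.Binary.PropositionalEquality
    using (_≡_; refl; sym; trans; cong; cong₂; subst; module ≡-Reasoning)

  sum-map-*ˡ : ∀ a (xs : List ℕ) → sum (map (a *_) xs) ≡ a * sum xs
  sum-map-*ˡ a []       = sym (*-zeroʳ a)
  sum-map-*ˡ a (x ∷ xs) = trans (cong (a * x +_) (sum-map-*ˡ a xs)) (sym (*-distribˡ-+ a x (sum xs)))

  -- X *[1- β t]≡ Y  says that the power series X · (1 - β t) equals Y.
  infix 4 _*[1-_t]≡_
  _*[1-_t]≡_ : Series → ℕ → Series → Set
  X *[1- β t]≡ Y = X 0 ≡ Y 0 × ∀ n → X (suc n) ≡ Y (suc n) + β * X n

  geomInv-⊛-*[1-t]≡ : ∀ a X → (geomInv a ⊛ X) *[1- a t]≡ X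
  geomInv-⊛-*[1-t]≡ a X = trans (+-identityʳ _) (*-identityˡ _) , coefficient-suc
    where
    coefficient-suc : ∀ n → (geomInv a ⊛ X) (suc n) ≡ X (suc n) + a * (geomInv a ⊛ X) n
    coefficient-suc n = cong₂ _+_ (*-identityˡ (X (suc n))) (begin
        sum (map term (applyUpTo suc (suc n)))
      ≡⟨ cong (sum ∘ map term) (sym (map-upTo suc (suc n))) ⟩
        sum (map term (map suc (upTo (suc n))))
      ≡⟨ cong sum (sym (map-∘ (upTo (suc n)))) ⟩
        sum (map (term ∘ suc) (upTo (suc n)))
      ≡⟨ cong sum (map-cong (λ k → *-assoc a (a ^ k) (X (n ∸ k))) (upTo (suc n))) ⟩
        sum (map ((a *_) ∘ term′) (upTo (suc n)))
      ≡⟨ cong sum (map-∘ (upTo (suc n))) ⟩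
        sum (map (a *_) (map term′ (upTo (suc n))))
      ≡⟨ sum-map-*ˡ a (map term′ (upTo (suc n))) ⟩
        a * (geomInv a ⊛ X) n ∎)
      where
      open ≡-Reasoning
      term term′ : ℕ → ℕ
      term k = geomInv a k * X (suc n ∸ k)
      term′ k = geomInv a k * X (n ∸ k)

  ⊛-preserves-*[1-t]≡ : ∀ a β X Y → X *[1- β t]≡ Y → (geomInv a ⊛ X) *[1- β t]≡ (geomInv a ⊛ Y)
  ⊛-preserves-*[1-t]≡ a β X Y (X₀≡Y₀ , X-rec) = GX₀≡GY₀ , rec
    where
    G = geomInv-⊛-*[1-t]≡
    GX GY : Series
    GX = geomInv a ⊛ X
    GY = geomInv a ⊛ Y
    GX₀≡GY₀ : GX 0 ≡ GY 0
    GX₀≡GY₀ = trans (proj₁ (G a X)) (trans X₀≡Y₀ (sym (proj₁ (G a Y))))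
    open ≡-Reasoning
    rec : ∀ n → GX (suc n) ≡ GY (suc n) + β * GX n
    rec zero = begin
        GX 1                     ≡⟨ proj₂ (G a X) 0 ⟩
        X 1 + a * GX 0           ≡⟨ cong₂ (λ x y → x + a * y) (X-rec 0) GX₀≡GY₀ ⟩
        Y 1 + β * X 0 + a * GY 0 ≡⟨ swap (Y 1) (β * X 0) (a * GY 0) ⟩
        Y 1 + a * GY 0 + β * X 0 ≡⟨ cong₂ (λ x y → x + β * y) (sym (proj₂ (G a Y) 0)) (sym (proj₁ (G a X))) ⟩
        GY 1 + β * GX 0          ∎
      where
      swap : ∀ x y z → x + y + z ≡ x + z + y
      swap = solve-∀
    rec (suc n) = begin
        GX (2 + n)
      ≡⟨ proj₂ (G a X) (suc n) ⟩
        X (2 + n) + a * GX (suc n)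
      ≡⟨ cong₂ (λ x y → x + a * y) (X-rec (suc n)) (rec n) ⟩
        Y (2 + n) + β * X (suc n) + a * (GY (suc n) + β * GX n)
      ≡⟨ regroup a β (Y (2 + n)) (X (suc n)) (GY (suc n)) (GX n) ⟩
        Y (2 + n) + a * GY (suc n) + β * (X (suc n) + a * GX n)
      ≡⟨ cong₂ (λ x y → x + β * y) (sym (proj₂ (G a Y) (suc n))) (sym (proj₂ (G a X) n)) ⟩
        GY (2 + n) + β * GX (suc n) ∎
      where
      regroup : ∀ a β y x v u → y + β * x + a * (v + β * u) ≡ y + a * v + β * (x + a * u)
      regroup = solve-∀

  foldr-⊛-*[1-t]≡ : ∀ (f : ℕ → ℕ) b X L →
                    foldr (λ r → geomInv (f r) ⊛_) (geomInv b ⊛ X) L *[1- b t]≡ foldr (λ r → geomInv (f r) ⊛_) X L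
  foldr-⊛-*[1-t]≡ f b X []      = geomInv-⊛-*[1-t]≡ b X
  foldr-⊛-*[1-t]≡ f b X (r ∷ L) =
    ⊛-preserves-*[1-t]≡ (f r) b (foldr factor (geomInv b ⊛ X) L) (foldr factor X L) (foldr-⊛-*[1-t]≡ f b X L)
    where
    factor : ℕ → Series → Series
    factor r = geomInv (f r) ⊛_

  prodInv-*[1-t]≡ : ∀ q i → prodInv q (suc i) *[1- q ^ suc i t]≡ prodInv q i
  prodInv-*[1-t]≡ q i = subst (_*[1- q ^ suc i t]≡ prodInv q i) (sym innermost-factor-last)
    (foldr-⊛-*[1-t]≡ (q ^_) (q ^ suc i) one (upTo (suc i)))
    where
    factor : ℕ → Series → Series
    factor r = geomInv (q ^ r) ⊛_
    innermost-factor-last : prodInv q (suc i) ≡ foldr factor (geomInv (q ^ suc i) ⊛ one) (upTo (suc i))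
    innermost-factor-last = trans (cong (foldr factor one) (sym (upTo-∷ʳ (suc i)))) (foldr-++ factor one (upTo (suc i)) [ suc i ])

  prodInv-constant : ∀ q i → prodInv q i 0 ≡ 1
  prodInv-constant q zero    = proj₁ (geomInv-⊛-*[1-t]≡ 1 one)
  prodInv-constant q (suc i) = trans (proj₁ (prodInv-*[1-t]≡ q i)) (prodInv-constant q i)

  shift-suc-*[1-t]≡ : ∀ β A B → A *[1- β t]≡ B →
                      ∀ i n → shift (suc i) A (suc n) ≡ shift i B n + β * shift (suc i) A n
  shift-suc-*[1-t]≡ β A B (A₀≡B₀ , _)   zero    zero    =
    trans A₀≡B₀ (sym (trans (cong (B 0 +_) (*-zeroʳ β)) (+-identityʳ _)))
  shift-suc-*[1-t]≡ β A B _             (suc i) zero    = sym (*-zeroʳ β)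
  shift-suc-*[1-t]≡ β A B (_ , A-rec)   zero    (suc n) = A-rec n
  shift-suc-*[1-t]≡ β A B A*[1-βt]≡B    (suc i) (suc n) = shift-suc-*[1-t]≡ β A B A*[1-βt]≡B i n

  echelonCount : ℕ → ℕ → ℕ → ℕ
  echelonCount q n i = shift i (prodInv q i) n

  echelonCount-zero-zero : ∀ q → echelonCount q 0 0 ≡ 1
  echelonCount-zero-zero q = prodInv-constant q 0

  echelonCount-suc-zero : ∀ q n → echelonCount q (suc n) 0 ≡ q ^ 0 * echelonCount q n 0
  echelonCount-suc-zero q n = proj₂ (geomInv-⊛-*[1-t]≡ 1 one) n

  echelonCount-suc-suc : ∀ q n i → echelonCount q (suc n) (suc i) ≡ echelonCount q n i + q ^ suc i * echelonCount q n (suc i)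
  echelonCount-suc-suc q n i = shift-suc-*[1-t]≡ (q ^ suc i) (prodInv q (suc i)) (prodInv q i) (prodInv-*[1-t]≡ q i) i n

  -- Reduced echelon forms of rank i with n columns over a set of q scalars, built by
  -- prepending columns: a new pivot column, or a column whose entries in the i pivot
  -- rows are arbitrary (and zero elsewhere).
  data Echelon (q : ℕ) : ℕ → ℕ → Set where
    []     : Echelon q 0 0
    pivot  : ∀ {n i} → Echelon q n i → Echelon q (suc n) (suc i)
    column : ∀ {n i} → Vec (Fin q) i → Echelon q n i → Echelon q (suc n) i

  Vec↔Fin^ : ∀ q i → Vec (Fin q) i ↔ Fin (q ^ i)
  Vec↔Fin^ q zero    = ↔-trans (mk↔ₛ′ _ (λ _ → Vec.[]) (λ _ → refl) (λ { Vec.[] → refl })) (↔-sym 1↔⊤)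
  Vec↔Fin^ q (suc i) = begin
    Vec (Fin q) (suc i)       ↔⟨ mk↔ₛ′ uncons (uncurry Vec._∷_) (λ _ → refl) (λ { (_ Vec.∷ _) → refl }) ⟩
    (Fin q × Vec (Fin q) i)   ↔⟨ ↔-refl ×-↔ Vec↔Fin^ q i ⟩
    (Fin q × Fin (q ^ i))     ↔⟨ ↔-sym *↔× ⟩
    Fin (q ^ suc i)           ∎
    where open EquationalReasoning

  Echelon↔Fin : ∀ q n i → Echelon q n i ↔ Fin (echelonCount q n i)
  Echelon↔Fin q zero zero = begin
    Echelon q 0 0             ↔⟨ mk↔ₛ′ _ (λ _ → []) (λ _ → refl) (λ { [] → refl }) ⟩
    ⊤                         ↔⟨ ↔-sym 1↔⊤ ⟩
    Fin 1                     ≡⟨ cong Fin (sym (echelonCount-zero-zero q)) ⟩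
    Fin (echelonCount q 0 0)  ∎
    where open EquationalReasoning
  Echelon↔Fin q zero (suc i) = ↔-trans (mk↔ₛ′ (λ ()) (λ ()) (λ ()) (λ ())) (↔-sym 0↔⊥)
  Echelon↔Fin q (suc n) zero = begin
    Echelon q (suc n) 0                         ↔⟨ mk↔ₛ′ (λ { (column v e) → v , e }) (uncurry column)
                                                          (λ _ → refl) (λ { (column v e) → refl }) ⟩
    (Vec (Fin q) 0 × Echelon q n 0)             ↔⟨ Vec↔Fin^ q 0 ×-↔ Echelon↔Fin q n 0 ⟩
    (Fin (q ^ 0) × Fin (echelonCount q n 0))    ↔⟨ ↔-sym *↔× ⟩
    Fin (q ^ 0 * echelonCount q n 0)            ≡⟨ cong Fin (sym (echelonCount-suc-zero q n)) ⟩
    Fin (echelonCount q (suc n) 0)              ∎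
    where open EquationalReasoning
  Echelon↔Fin q (suc n) (suc i) = begin
    Echelon q (suc n) (suc i)
      ↔⟨ mk↔ₛ′ split join (λ { (inj₁ e) → refl ; (inj₂ (v , e)) → refl })
                          (λ { (pivot e) → refl ; (column v e) → refl }) ⟩
    (Echelon q n i ⊎ (Vec (Fin q) (suc i) × Echelon q n (suc i)))
      ↔⟨ Echelon↔Fin q n i ⊎-↔ (Vec↔Fin^ q (suc i) ×-↔ Echelon↔Fin q n (suc i)) ⟩
    (Fin (echelonCount q n i) ⊎ (Fin (q ^ suc i) × Fin (echelonCount q n (suc i))))
      ↔⟨ ↔-refl ⊎-↔ ↔-sym *↔× ⟩
    (Fin (echelonCount q n i) ⊎ Fin (q ^ suc i * echelonCount q n (suc i)))
      ↔⟨ ↔-sym +↔⊎ ⟩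
    Fin (echelonCount q n i + q ^ suc i * echelonCount q n (suc i))
      ≡⟨ cong Fin (sym (echelonCount-suc-suc q n i)) ⟩
    Fin (echelonCount q (suc n) (suc i)) ∎
    where
    open EquationalReasoning
    split : Echelon q (suc n) (suc i) → Echelon q n i ⊎ (Vec (Fin q) (suc i) × Echelon q n (suc i))
    split (pivot e)    = inj₁ e
    split (column v e) = inj₂ (v , e)
    join : Echelon q n i ⊎ (Vec (Fin q) (suc i) × Echelon q n (suc i)) → Echelon q (suc n) (suc i)
    join (inj₁ e)       = pivot e
    join (inj₂ (v , e)) = column v e

  Σ<↔Fin-sum : ∀ {A : ℕ → Set} (h : ℕ → ℕ) → (∀ i → A i ↔ Fin (h i)) →
               ∀ k → (Σ ℕ λ i → i < k × A i) ↔ Fin (sum (applyUpTo h k))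
  Σ<↔Fin-sum h A↔ zero    = ↔-trans (mk↔ₛ′ (λ { (_ , () , _) }) (λ ()) (λ ()) (λ { (_ , () , _) })) (↔-sym 0↔⊥)
  Σ<↔Fin-sum {A} h A↔ (suc k) = begin
    (Σ ℕ λ i → i < suc k × A i)                      ↔⟨ mk↔ₛ′ split join split-join join-split ⟩
    (A 0 ⊎ Σ ℕ λ i → i < k × A (suc i))              ↔⟨ A↔ 0 ⊎-↔ Σ<↔Fin-sum (h ∘ suc) (A↔ ∘ suc) k ⟩
    (Fin (h 0) ⊎ Fin (sum (applyUpTo (h ∘ suc) k)))  ↔⟨ ↔-sym +↔⊎ ⟩
    Fin (sum (applyUpTo h (suc k)))                  ∎
    where
    open EquationalReasoning
    split : (Σ ℕ λ i → i < suc k × A i) → A 0 ⊎ Σ ℕ λ i → i < k × A (suc i)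
    split (zero  , _       , a) = inj₁ a
    split (suc i , s≤s i<k , a) = inj₂ (i , i<k , a)
    join : (A 0 ⊎ Σ ℕ λ i → i < k × A (suc i)) → Σ ℕ λ i → i < suc k × A i
    join (inj₁ a)             = 0 , s≤s z≤n , a
    join (inj₂ (i , i<k , a)) = suc i , s≤s i<k , a
    split-join : ∀ x → split (join x) ≡ x
    split-join (inj₁ a) = refl
    split-join (inj₂ _) = refl
    join-split : ∀ x → join (split x) ≡ x
    join-split (zero  , s≤s z≤n , a) = refl
    join-split (suc i , s≤s _   , a) = refl

  Echelon≤ : ℕ → ℕ → ℕ → Set
  Echelon≤ q m n = Σ ℕ λ i → i < suc m × Echelon q n i

  Echelon≤↔Fin : ∀ q m n → Echelon≤ q m n ↔ Fin (rhsSeries q m n)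
  Echelon≤↔Fin q m n = subst (λ k → Echelon≤ q m n ↔ Fin k) (cong sum (sym (map-upTo (echelonCount q n) (suc m))))
    (Σ<↔Fin-sum (echelonCount q n) (Echelon↔Fin q n) (suc m))

open EchelonCount using (Echelon; []; pivot; column; Echelon≤; Echelon≤↔Fin)

module Orbits {c ℓ} {q : ℕ} (F : FiniteField c ℓ q) where

  open import Algebra.Bundles using (CommutativeRing)
  open import Data.Nat as ℕ using (zero; suc; _≡ᵇ_; z≤n; s≤s)
  import Data.Nat.Properties as ℕ
  open import Data.Fin as Fin using (Fin; toℕ; fromℕ<; inject≤)
  import Data.Fin.Properties as Fin
  open import Data.Vec.Functional using (_∷_)
  open import Data.Vec using (Vec; lookup; tabulate)
  import Data.Vec.Properties as Vec
  open import Data.Bool using (true; false; if_then_else_; T)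
  open import Level using (_⊔_)
  open import Data.Product using (Σ; ∃; _×_; _,_; proj₁; proj₂)
  open import Data.Sum using (_⊎_; inj₁; inj₂)
  open import Data.Empty using (⊥-elim)
  open import Relation.Nullary using (¬_; yes; no; ¬?; _×-dec_)
  open import Relation.Nullary.Decidable using (decidable-stable)
  open import Relation.Binary.PropositionalEquality as ≡ using (_≡_; _≢_)
  open import Function using (_∘_)
  open import Function.Bundles using (_⇔_; mk⇔; _↔_; Inverse; Equivalence)

  open FiniteField F renaming (ring to R)
  open CommutativeRing R hiding (ring)
  open IsFieldOn isField
  open HasCard card
  open LinAlg R
  open import Algebra.Properties.Semiring.Sum semiring
    using (sum-cong-≋; ∑-distrib-+; ∑-comm; *-distribˡ-sum; *-distribʳ-sum; sum-replicate-zero)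
    renaming (sum to ∑)
  open import Algebra.Solver.Ring.NaturalCoefficients.Default commutativeSemiring
    using (solve; _:=_; _:+_; _:*_; con)
  open import Relation.Binary.Reasoning.Setoid setoid
  open import Data.Vec.Functional.Relation.Binary.Equality.Setoid setoid using (≋-refl; ≋-sym; ≋-trans)

  Σᶠ≡∑ : ∀ {k} (f : Fin k → Carrier) → Σᶠ f ≡ ∑ f
  Σᶠ≡∑ {zero}  f = ≡.refl
  Σᶠ≡∑ {suc k} f = ≡.cong (f Fin.zero +_) (Σᶠ≡∑ (λ t → f (Fin.suc t)))

  Σᶠ-cong : ∀ {k} {f g : Fin k → Carrier} → (∀ t → f t ≈ g t) → Σᶠ f ≈ Σᶠ g
  Σᶠ-cong {f = f} {g} f≈g = begin
    Σᶠ f  ≡⟨ Σᶠ≡∑ f ⟩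
    ∑ f   ≈⟨ sum-cong-≋ f≈g ⟩
    ∑ g   ≡⟨ Σᶠ≡∑ g ⟨
    Σᶠ g  ∎

  Σᶠ-distrib-+ : ∀ {k} (f g : Fin k → Carrier) → Σᶠ (λ t → f t + g t) ≈ Σᶠ f + Σᶠ g
  Σᶠ-distrib-+ f g = begin
    Σᶠ (λ t → f t + g t) ≡⟨ Σᶠ≡∑ (λ t → f t + g t) ⟩
    ∑ (λ t → f t + g t)  ≈⟨ ∑-distrib-+ f g ⟩
    ∑ f + ∑ g            ≡⟨ ≡.cong₂ _+_ (Σᶠ≡∑ f) (Σᶠ≡∑ g) ⟨
    Σᶠ f + Σᶠ g          ∎

  *-distribˡ-Σᶠ : ∀ {k} a (f : Fin k → Carrier) → a * Σᶠ f ≈ Σᶠ (λ t → a * f t)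
  *-distribˡ-Σᶠ a f = begin
    a * Σᶠ f            ≡⟨ ≡.cong (a *_) (Σᶠ≡∑ f) ⟩
    a * ∑ f             ≈⟨ *-distribˡ-sum a f ⟩
    ∑ (λ t → a * f t)   ≡⟨ Σᶠ≡∑ (λ t → a * f t) ⟨
    Σᶠ (λ t → a * f t)  ∎

  *-distribʳ-Σᶠ : ∀ {k} a (f : Fin k → Carrier) → Σᶠ f * a ≈ Σᶠ (λ t → f t * a)
  *-distribʳ-Σᶠ a f = begin
    Σᶠ f * a            ≡⟨ ≡.cong (_* a) (Σᶠ≡∑ f) ⟩
    ∑ f * a             ≈⟨ *-distribʳ-sum a f ⟩
    ∑ (λ t → f t * a)   ≡⟨ Σᶠ≡∑ (λ t → f t * a) ⟨
    Σᶠ (λ t → f t * a)  ∎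

  Σᶠ-comm : ∀ {k l} (f : Fin k → Fin l → Carrier) →
            Σᶠ (λ s → Σᶠ (λ t → f s t)) ≈ Σᶠ (λ t → Σᶠ (λ s → f s t))
  Σᶠ-comm f = begin
    Σᶠ (λ s → Σᶠ (λ t → f s t)) ≈⟨ Σᶠ-cong (λ s → reflexive (Σᶠ≡∑ (f s))) ⟩
    Σᶠ (λ s → ∑ (λ t → f s t))  ≡⟨ Σᶠ≡∑ (λ s → ∑ (λ t → f s t)) ⟩
    ∑ (λ s → ∑ (λ t → f s t))   ≈⟨ ∑-comm f ⟩
    ∑ (λ t → ∑ (λ s → f s t))   ≡⟨ Σᶠ≡∑ (λ t → ∑ (λ s → f s t)) ⟨
    Σᶠ (λ t → ∑ (λ s → f s t))  ≈⟨ Σᶠ-cong (λ t → reflexive (Σᶠ≡∑ (λ s → f s t))) ⟨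
    Σᶠ (λ t → Σᶠ (λ s → f s t)) ∎

  Σᶠ-zero : ∀ k → Σᶠ {k} (λ _ → 0#) ≈ 0#
  Σᶠ-zero k = trans (reflexive (Σᶠ≡∑ {k} (λ _ → 0#))) (sum-replicate-zero k)

  δ : ℕ → ℕ → Carrier
  δ a b = if a ≡ᵇ b then 1# else 0#

  δ-refl : ∀ a → δ a a ≡ 1#
  δ-refl zero    = ≡.refl
  δ-refl (suc a) = δ-refl a

  δ-≢ : ∀ {a b} → a ≢ b → δ a b ≡ 0#
  δ-≢ {a} {b} a≢b with a ≡ᵇ b in eq
  ... | false = ≡.refl
  ... | true  = ⊥-elim (a≢b (ℕ.≡ᵇ⇒≡ a b (≡.subst T (≡.sym eq) _)))

  -- e_r, or the zero vector when r ≥ m.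
  basis : ∀ {m} → ℕ → Vector m
  basis r j = δ (toℕ j) r

  Σᶠ-*δ : ∀ {k} (a : Fin k → Carrier) (j : Fin k) → Σᶠ (λ t → a t * δ (toℕ j) (toℕ t)) ≈ a j
  Σᶠ-*δ {suc k} a Fin.zero = begin
    a Fin.zero * 1# + Σᶠ (λ t → a (Fin.suc t) * 0#)
      ≈⟨ +-cong (*-identityʳ _) (trans (Σᶠ-cong (λ t → zeroʳ (a (Fin.suc t)))) (Σᶠ-zero k)) ⟩
    a Fin.zero + 0#
      ≈⟨ +-identityʳ _ ⟩
    a Fin.zero ∎
  Σᶠ-*δ {suc k} a (Fin.suc j) = trans (+-cong (zeroʳ _) (Σᶠ-*δ (λ t → a (Fin.suc t)) j)) (+-identityˡ _)

  _+ᵛ_ : ∀ {m} → Vector m → Vector m → Vector m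
  (u +ᵛ v) j = u j + v j

  _·ᵛ_ : ∀ {m} → Carrier → Vector m → Vector m
  (a ·ᵛ v) j = a * v j

  Σᵛ : ∀ {m k} → (Fin k → Vector m) → Vector m
  Σᵛ vs j = Σᶠ (λ t → vs t j)

  expand-basis : ∀ {m} (v : Vector m) → v ≈ᵛ Σᵛ (λ t → v t ·ᵛ basis (toℕ t))
  expand-basis v j = sym (Σᶠ-*δ v j)

  record LinearMap (m : ℕ) : Set (c ⊔ ℓ) where
    field
      ⟦_⟧     : Vector m → Vector m
      ⟦⟧-cong : ∀ {u v} → u ≈ᵛ v → ⟦ u ⟧ ≈ᵛ ⟦ v ⟧
      ⟦⟧-+    : ∀ u v → ⟦ u +ᵛ v ⟧ ≈ᵛ (⟦ u ⟧ +ᵛ ⟦ v ⟧)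
      ⟦⟧-·    : ∀ a v → ⟦ a ·ᵛ v ⟧ ≈ᵛ (a ·ᵛ ⟦ v ⟧)
  open LinearMap

  idᴸ : ∀ {m} → LinearMap m
  idᴸ = record { ⟦_⟧ = λ v → v ; ⟦⟧-cong = λ u≈v → u≈v ; ⟦⟧-+ = λ _ _ → ≋-refl ; ⟦⟧-· = λ _ _ → ≋-refl }

  _∘ᴸ_ : ∀ {m} → LinearMap m → LinearMap m → LinearMap m
  L ∘ᴸ M = record
    { ⟦_⟧     = λ v → ⟦ L ⟧ (⟦ M ⟧ v)
    ; ⟦⟧-cong = λ u≈v → ⟦⟧-cong L (⟦⟧-cong M u≈v)
    ; ⟦⟧-+    = λ u v → ≋-trans (⟦⟧-cong L (⟦⟧-+ M u v)) (⟦⟧-+ L _ _)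
    ; ⟦⟧-·    = λ a v → ≋-trans (⟦⟧-cong L (⟦⟧-· M a v)) (⟦⟧-· L _ _)
    }

  ⟦⟧-0 : ∀ {m} (L : LinearMap m) → ⟦ L ⟧ (λ _ → 0#) ≈ᵛ (λ _ → 0#)
  ⟦⟧-0 L = ≋-trans (⟦⟧-cong L (λ _ → sym (zeroˡ 0#))) (≋-trans (⟦⟧-· L 0# (λ _ → 0#)) (λ _ → zeroˡ _))

  ⟦⟧-Σ : ∀ {m k} (L : LinearMap m) (vs : Fin k → Vector m) → ⟦ L ⟧ (Σᵛ vs) ≈ᵛ Σᵛ (λ t → ⟦ L ⟧ (vs t))
  ⟦⟧-Σ {k = zero}  L vs = ⟦⟧-0 L
  ⟦⟧-Σ {k = suc k} L vs = ≋-trans (⟦⟧-+ L _ _) (λ j → +-congˡ (⟦⟧-Σ L (λ t → vs (Fin.suc t)) j))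

  ⟦⟧-expand-basis : ∀ {m} (L : LinearMap m) (v : Vector m) → ⟦ L ⟧ v ≈ᵛ Σᵛ (λ t → v t ·ᵛ ⟦ L ⟧ (basis (toℕ t)))
  ⟦⟧-expand-basis L v = ≋-trans (⟦⟧-cong L (expand-basis v))
    (≋-trans (⟦⟧-Σ L (λ t → v t ·ᵛ basis (toℕ t))) (λ j → Σᶠ-cong (λ t → ⟦⟧-· L (v t) (basis (toℕ t)) j)))

  record Automorphism (m : ℕ) : Set (c ⊔ ℓ) where
    field
      to from  : LinearMap m
      inverseˡ : ∀ v → ⟦ to ⟧ (⟦ from ⟧ v) ≈ᵛ v
      inverseʳ : ∀ v → ⟦ from ⟧ (⟦ to ⟧ v) ≈ᵛ v
  open Automorphism

  idᴬ : ∀ {m} → Automorphism m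
  idᴬ = record { to = idᴸ ; from = idᴸ ; inverseˡ = λ _ → ≋-refl ; inverseʳ = λ _ → ≋-refl }

  _⁻¹ᴬ : ∀ {m} → Automorphism m → Automorphism m
  φ ⁻¹ᴬ = record { to = from φ ; from = to φ ; inverseˡ = inverseʳ φ ; inverseʳ = inverseˡ φ }

  _∘ᴬ_ : ∀ {m} → Automorphism m → Automorphism m → Automorphism m
  φ ∘ᴬ ψ = record
    { to       = to φ ∘ᴸ to ψ
    ; from     = from ψ ∘ᴸ from φ
    ; inverseˡ = λ v → ≋-trans (⟦⟧-cong (to φ) (inverseˡ ψ _)) (inverseˡ φ v)
    ; inverseʳ = λ v → ≋-trans (⟦⟧-cong (from ψ) (inverseʳ φ _)) (inverseʳ ψ v)
    }

  to-injective : ∀ {m} (φ : Automorphism m) {u v} → ⟦ to φ ⟧ u ≈ᵛ ⟦ to φ ⟧ v → u ≈ᵛ v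
  to-injective φ {u} {v} eq = ≋-trans (≋-sym (inverseʳ φ u)) (≋-trans (⟦⟧-cong (from φ) eq) (inverseʳ φ v))

  applyᴸ : ∀ {m} → Matrix m → LinearMap m
  applyᴸ A = record
    { ⟦_⟧     = apply A
    ; ⟦⟧-cong = λ u≈v i → Σᶠ-cong (λ k → *-congˡ (u≈v k))
    ; ⟦⟧-+    = λ u v i → trans (Σᶠ-cong (λ k → distribˡ (A i k) (u k) (v k)))
                                (Σᶠ-distrib-+ (λ k → A i k * u k) (λ k → A i k * v k))
    ; ⟦⟧-·    = λ a v i → trans (Σᶠ-cong (λ k → x[ay]≈a[xy] (A i k) a (v k)))
                                (sym (*-distribˡ-Σᶠ a (λ k → A i k * v k)))
    }
    where
    x[ay]≈a[xy] : ∀ x a y → x * (a * y) ≈ a * (x * y)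
    x[ay]≈a[xy] = solve 3 (λ x a y → x :* (a :* y) := a :* (x :* y)) refl

  apply-congˡ : ∀ {m} {A B : Matrix m} (v : Vector m) → A ≈ᴹ B → apply A v ≈ᵛ apply B v
  apply-congˡ v A≈B i = Σᶠ-cong (λ k → *-congʳ (A≈B i k))

  apply-⊗ : ∀ {m} (A B : Matrix m) (v : Vector m) → apply (A ⊗ B) v ≈ᵛ apply A (apply B v)
  apply-⊗ A B v i = begin
    Σᶠ (λ k → Σᶠ (λ l → A i l * B l k) * v k)   ≈⟨ Σᶠ-cong (λ k → *-distribʳ-Σᶠ (v k) (λ l → A i l * B l k)) ⟩
    Σᶠ (λ k → Σᶠ (λ l → A i l * B l k * v k))   ≈⟨ Σᶠ-comm (λ k l → A i l * B l k * v k) ⟩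
    Σᶠ (λ l → Σᶠ (λ k → A i l * B l k * v k))   ≈⟨ Σᶠ-cong (λ l → Σᶠ-cong (λ k → *-assoc (A i l) (B l k) (v k))) ⟩
    Σᶠ (λ l → Σᶠ (λ k → A i l * (B l k * v k))) ≈⟨ Σᶠ-cong (λ l → *-distribˡ-Σᶠ (A i l) (λ k → B l k * v k)) ⟨
    Σᶠ (λ l → A i l * Σᶠ (λ k → B l k * v k))   ∎

  apply-I : ∀ {m} (v : Vector m) → apply I v ≈ᵛ v
  apply-I v i = trans (Σᶠ-cong (λ k → *-comm _ (v k))) (Σᶠ-*δ v i)

  invertible⇒Automorphism : ∀ {m} (g : Matrix m) → IsInvertible g → Automorphism m
  invertible⇒Automorphism g (g⁻¹ , gg⁻¹≈I , g⁻¹g≈I) = record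
    { to       = applyᴸ g
    ; from     = applyᴸ g⁻¹
    ; inverseˡ = λ v → ≋-trans (≋-sym (apply-⊗ g g⁻¹ v)) (≋-trans (apply-congˡ v gg⁻¹≈I) (apply-I v))
    ; inverseʳ = λ v → ≋-trans (≋-sym (apply-⊗ g⁻¹ g v)) (≋-trans (apply-congˡ v g⁻¹g≈I) (apply-I v))
    }

  matrixOf : ∀ {m} → LinearMap m → Matrix m
  matrixOf L i j = ⟦ L ⟧ (basis (toℕ j)) i

  apply-matrixOf : ∀ {m} (L : LinearMap m) (v : Vector m) → apply (matrixOf L) v ≈ᵛ ⟦ L ⟧ v
  apply-matrixOf L v i = sym (trans (⟦⟧-expand-basis L v i) (Σᶠ-cong (λ t → *-comm (v t) _)))

  matrixOf-invertible : ∀ {m} (φ : Automorphism m) → IsInvertible (matrixOf (to φ))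
  matrixOf-invertible φ = matrixOf (from φ)
    , (λ i j → trans (apply-matrixOf (to φ) _ i) (inverseˡ φ (basis (toℕ j)) i))
    , (λ i j → trans (apply-matrixOf (from φ) _ i) (inverseʳ φ (basis (toℕ j)) i))

  -- The GL_m-orbits described by linear automorphisms instead of invertible matrices,
  -- so that elimination steps can be given as functions.
  AutOrbit : ∀ {m n} → Tuple m n → Tuple m n → Set (c ⊔ ℓ)
  AutOrbit x y = Σ (Automorphism _) λ φ → ∀ j → ⟦ to φ ⟧ (x j) ≈ᵛ y j

  SameOrbit⇔AutOrbit : ∀ {m n} {x y : Tuple m n} → SameOrbit x y ⇔ AutOrbit x y
  SameOrbit⇔AutOrbit = mk⇔
    (λ { (g , g-inv , gx≈y) → invertible⇒Automorphism g g-inv , gx≈y })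
    (λ { (φ , φx≈y) → matrixOf (to φ) , matrixOf-invertible φ , (λ j → ≋-trans (apply-matrixOf (to φ) _) (φx≈y j)) })

  AutOrbit-sym : ∀ {m n} {x y : Tuple m n} → AutOrbit x y → AutOrbit y x
  AutOrbit-sym (φ , φx≈y) = φ ⁻¹ᴬ , λ j → ≋-trans (⟦⟧-cong (from φ) (≋-sym (φx≈y j))) (inverseʳ φ _)

  AutOrbit-trans : ∀ {m n} {x y z : Tuple m n} → AutOrbit x y → AutOrbit y z → AutOrbit x z
  AutOrbit-trans (φ , φx≈y) (ψ , ψy≈z) = ψ ∘ᴬ φ , λ j → ≋-trans (⟦⟧-cong (to ψ) (φx≈y j)) (ψy≈z j)

  SupportedBelow : ∀ {m} → ℕ → Vector m → Set ℓ
  SupportedBelow i u = ∀ j → i ℕ.≤ toℕ j → u j ≈ 0#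

  FixesSupportedBelow : ∀ {m} → ℕ → LinearMap m → Set (c ⊔ ℓ)
  FixesSupportedBelow i L = ∀ u → SupportedBelow i u → ⟦ L ⟧ u ≈ᵛ u

  fixes-basis⇒fixes-supportedBelow : ∀ {m} (L : LinearMap m) i →
    (∀ r → r ℕ.< i → ⟦ L ⟧ (basis r) ≈ᵛ basis r) → FixesSupportedBelow i L
  fixes-basis⇒fixes-supportedBelow L i fixes v v-below j =
    trans (⟦⟧-expand-basis L v j) (trans (Σᶠ-cong coordinate) (sym (expand-basis v j)))
    where
    coordinate : ∀ t → v t * ⟦ L ⟧ (basis (toℕ t)) j ≈ v t * basis (toℕ t) j
    coordinate t with toℕ t ℕ.<? i
    ... | yes t<i = *-congˡ (fixes (toℕ t) t<i j)
    ... | no  t≮i = trans (vt*x≈0 _) (sym (vt*x≈0 _))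
      where
      vt*x≈0 : ∀ x → v t * x ≈ 0#
      vt*x≈0 x = trans (*-congʳ (v-below t (ℕ.≮⇒≥ t≮i))) (zeroˡ x)

  transvection : ∀ {m} → Vector m → Fin m → LinearMap m
  transvection d t = record
    { ⟦_⟧     = λ y j → y j + y t * d j
    ; ⟦⟧-cong = λ u≈v j → +-cong (u≈v j) (*-congʳ (u≈v t))
    ; ⟦⟧-+    = λ u v j → additive (u j) (v j) (u t) (v t) (d j)
    ; ⟦⟧-·    = λ a y j → homogeneous a (y j) (y t) (d j)
    }
    where
    additive : ∀ uj vj ut vt dj → (uj + vj) + (ut + vt) * dj ≈ (uj + ut * dj) + (vj + vt * dj)
    additive = solve 5 (λ uj vj ut vt dj → (uj :+ vj) :+ (ut :+ vt) :* dj := (uj :+ ut :* dj) :+ (vj :+ vt :* dj)) refl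
    homogeneous : ∀ a yj yt dj → a * yj + (a * yt) * dj ≈ a * (yj + yt * dj)
    homogeneous = solve 4 (λ a yj yt dj → a :* yj :+ (a :* yt) :* dj := a :* (yj :+ yt :* dj)) refl

  transvection-fixes : ∀ {m} (d : Vector m) (t : Fin m) {i} → i ℕ.≤ toℕ t → FixesSupportedBelow i (transvection d t)
  transvection-fixes d t i≤t y y-below j = trans (+-congˡ (trans (*-congʳ (y-below t i≤t)) (zeroˡ _))) (+-identityʳ _)

  transvection-cancel : ∀ {m} (d e : Vector m) t → (∀ j → d j + (1# + d t) * e j ≈ 0#) →
                        ∀ y → ⟦ transvection e t ⟧ (⟦ transvection d t ⟧ y) ≈ᵛ y
  transvection-cancel d e t d∘e≈0 y j = begin
    (y j + y t * d j) + (y t + y t * d t) * e j ≈⟨ regroup (y j) (y t) (d j) (d t) (e j) ⟩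
    y j + y t * (d j + (1# + d t) * e j)       ≈⟨ +-congˡ (trans (*-congˡ (d∘e≈0 j)) (zeroʳ _)) ⟩
    y j + 0#                                   ≈⟨ +-identityʳ _ ⟩
    y j                                        ∎
    where
    regroup : ∀ yj yt dj dt ej → (yj + yt * dj) + (yt + yt * dt) * ej ≈ yj + yt * (dj + (1# + dt) * ej)
    regroup = solve 5 (λ yj yt dj dt ej → (yj :+ yt :* dj) :+ (yt :+ yt :* dt) :* ej
                                          := yj :+ yt :* (dj :+ (con 1 :+ dt) :* ej)) refl

  -- The semiring solver cannot see negation, so -1 enters the identities below as a
  -- variable subject to 1 + -1 ≈ 0.
  -1# : Carrier
  -1# = - 1#

  1+-1≈0 : 1# + -1# ≈ 0#
  1+-1≈0 = -‿inverseʳ 1#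

  -- When 1 + d_t is a unit, y ↦ y + y_t d is inverted by the transvection along -(1 + d_t)⁻¹ d.
  transvectionAut : ∀ {m} (d : Vector m) (t : Fin m) (κ : Carrier) → (1# + d t) * κ ≈ 1# → Automorphism m
  transvectionAut d t κ unit = record
    { to       = transvection d t
    ; from     = transvection e t
    ; inverseˡ = transvection-cancel e d t (λ j → trans (e∘d (d j) (d t) -1# κ) (vanishes (d j)))
    ; inverseʳ = transvection-cancel d e t (λ j → trans (d∘e (d j) (d t) -1# κ) (vanishes (d j)))
    }
    where
    e : Vector _
    e j = -1# * (κ * d j)
    vanishes : ∀ x → x * (1# + -1# * ((1# + d t) * κ)) ≈ 0#
    vanishes x = trans (*-congˡ (trans (+-congˡ (trans (*-congˡ unit) (*-identityʳ -1#))) 1+-1≈0)) (zeroʳ x)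
    d∘e : ∀ x dt n k → x + (1# + dt) * (n * (k * x)) ≈ x * (1# + n * ((1# + dt) * k))
    d∘e = solve 4 (λ x dt n k → x :+ (con 1 :+ dt) :* (n :* (k :* x)) := x :* (con 1 :+ n :* ((con 1 :+ dt) :* k))) refl
    e∘d : ∀ x dt n k → n * (k * x) + (1# + n * (k * dt)) * x ≈ x * (1# + n * ((1# + dt) * k))
    e∘d = solve 4 (λ x dt n k → n :* (k :* x) :+ (con 1 :+ n :* (k :* dt)) :* x := x :* (con 1 :+ n :* ((con 1 :+ dt) :* k))) refl

  moveNonzeroTo : ∀ {m} (w : Vector m) (ι s : Fin m) → toℕ ι ℕ.≤ toℕ s → ¬ w s ≈ 0# →
                  Σ (Automorphism m) λ φ → FixesSupportedBelow (toℕ ι) (to φ) × ¬ ⟦ to φ ⟧ w ι ≈ 0#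
  moveNonzeroTo w ι s ι≤s ws≉0 with w ι ≟ 0#
  ... | no  wι≉0 = idᴬ , (λ _ _ → ≋-refl) , wι≉0
  ... | yes wι≈0 = transvectionAut eι s 1# unit , transvection-fixes eι s ι≤s , nonzero
    where
    eι : Vector _
    eι = basis (toℕ ι)
    eι[s]≈0 : eι s ≈ 0#
    eι[s]≈0 = reflexive (δ-≢ λ s≡ι → ws≉0 (trans (reflexive (≡.cong w (Fin.toℕ-injective s≡ι))) wι≈0))
    unit : (1# + eι s) * 1# ≈ 1#
    unit = trans (*-identityʳ _) (trans (+-congˡ eι[s]≈0) (+-identityʳ 1#))
    nonzero : ¬ w ι + w s * eι ι ≈ 0#
    nonzero wι+ws≈0 = ws≉0 (begin
      w s                ≈⟨ *-identityʳ (w s) ⟨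
      w s * 1#           ≈⟨ +-identityˡ _ ⟨
      0# + w s * 1#      ≈⟨ +-cong wι≈0 (*-congˡ (reflexive (δ-refl (toℕ ι)))) ⟨
      w ι + w s * eι ι   ≈⟨ wι+ws≈0 ⟩
      0#                 ∎)

  normaliseAt : ∀ {m} (u : Vector m) (ι : Fin m) → ¬ u ι ≈ 0# →
                Σ (Automorphism m) λ φ → FixesSupportedBelow (toℕ ι) (to φ) × ⟦ to φ ⟧ u ≈ᵛ basis (toℕ ι)
  normaliseAt u ι uι≉0 = τ ⁻¹ᴬ , transvection-fixes _ ι ℕ.≤-refl , u↦eι
    where
    eι : Vector _
    eι = basis (toℕ ι)
    eι[ι]≈1 : eι ι ≈ 1#
    eι[ι]≈1 = reflexive (δ-refl (toℕ ι))
    uι⁻¹ : Carrier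
    uι⁻¹ = proj₁ (inverse (u ι) uι≉0)
    -- τ is the transvection along u - e_ι, which sends e_ι to u.
    d : Vector _
    d j = u j + -1# * eι j
    unit : (1# + d ι) * uι⁻¹ ≈ 1#
    unit = begin
      (1# + (u ι + -1# * eι ι)) * uι⁻¹  ≈⟨ *-congʳ (+-congˡ (+-congˡ (*-congˡ eι[ι]≈1))) ⟩
      (1# + (u ι + -1# * 1#)) * uι⁻¹    ≈⟨ regroup (u ι) -1# uι⁻¹ ⟩
      u ι * uι⁻¹ + (1# + -1#) * uι⁻¹    ≈⟨ +-cong (proj₂ (inverse (u ι) uι≉0)) (trans (*-congʳ 1+-1≈0) (zeroˡ uι⁻¹)) ⟩
      1# + 0#                           ≈⟨ +-identityʳ 1# ⟩
      1#                                ∎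
      where
      regroup : ∀ x n y → (1# + (x + n * 1#)) * y ≈ x * y + (1# + n) * y
      regroup = solve 3 (λ x n y → (con 1 :+ (x :+ n :* con 1)) :* y := x :* y :+ (con 1 :+ n) :* y) refl
    τ : Automorphism _
    τ = transvectionAut d ι uι⁻¹ unit
    eι↦u : ⟦ to τ ⟧ eι ≈ᵛ u
    eι↦u j = begin
      eι j + eι ι * (u j + -1# * eι j) ≈⟨ +-congˡ (*-congʳ eι[ι]≈1) ⟩
      eι j + 1# * (u j + -1# * eι j)   ≈⟨ regroup (eι j) (u j) -1# ⟩
      u j + eι j * (1# + -1#)          ≈⟨ +-congˡ (trans (*-congˡ 1+-1≈0) (zeroʳ _)) ⟩
      u j + 0#                         ≈⟨ +-identityʳ _ ⟩
      u j                              ∎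
      where
      regroup : ∀ e u n → e + 1# * (u + n * e) ≈ u + e * (1# + n)
      regroup = solve 3 (λ e u n → e :+ con 1 :* (u :+ n :* e) := u :+ e :* (con 1 :+ n)) refl
    u↦eι : ⟦ from τ ⟧ u ≈ᵛ eι
    u↦eι = ≋-trans (⟦⟧-cong (from τ) (≋-sym eι↦u)) (inverseʳ τ eι)

  pivotAt : ∀ {m} i (w : Vector m) (s : Fin m) → i ℕ.≤ toℕ s → ¬ w s ≈ 0# →
            Σ (Automorphism m) λ φ → FixesSupportedBelow i (to φ) × ⟦ to φ ⟧ w ≈ᵛ basis i
  pivotAt i w s i≤s ws≉0
    with fromℕ< (ℕ.≤-<-trans i≤s (Fin.toℕ<n s)) | Fin.toℕ-fromℕ< (ℕ.≤-<-trans i≤s (Fin.toℕ<n s))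
  ... | ι | ≡.refl =
    let φ , φ-fixes , φw[ι]≉0 = moveNonzeroTo w ι s i≤s ws≉0
        ψ , ψ-fixes , ψφw≈eι  = normaliseAt (⟦ to φ ⟧ w) ι φw[ι]≉0
    in ψ ∘ᴬ φ , (λ v v-below → ≋-trans (⟦⟧-cong (to ψ) (φ-fixes v v-below)) (ψ-fixes v v-below)) , ψφw≈eι

  nonzeroFrom⊎supportedBelow : ∀ {m} i (w : Vector m) → (∃ λ s → i ℕ.≤ toℕ s × ¬ w s ≈ 0#) ⊎ SupportedBelow i w
  nonzeroFrom⊎supportedBelow i w with Fin.any? (λ s → i ℕ.≤? toℕ s ×-dec ¬? (w s ≟ 0#))
  ... | yes found   = inj₁ found
  ... | no  ¬found  = inj₂ λ s i≤s → decidable-stable (w s ≟ 0#) (λ ws≉0 → ¬found (s , i≤s , ws≉0))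

  padZero : ∀ {k} → (Fin k → Carrier) → ℕ → Carrier
  padZero {zero}  a _       = 0#
  padZero {suc k} a zero    = a Fin.zero
  padZero {suc k} a (suc r) = padZero (λ t → a (Fin.suc t)) r

  padZero-toℕ : ∀ {k} (a : Fin k → Carrier) t → padZero a (toℕ t) ≡ a t
  padZero-toℕ a Fin.zero    = ≡.refl
  padZero-toℕ a (Fin.suc t) = padZero-toℕ (λ t → a (Fin.suc t)) t

  padZero-≥ : ∀ {k} (a : Fin k → Carrier) {r} → k ℕ.≤ r → padZero a r ≡ 0#
  padZero-≥ {zero}  a         _         = ≡.refl
  padZero-≥ {suc k} a {suc r} (s≤s k≤r) = padZero-≥ (λ t → a (Fin.suc t)) k≤r

  -- The column with the scalars enumerated by v in its i pivot rows.
  embed : ∀ {m i} → Vec (Fin q) i → Vector m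
  embed v j = padZero (enum ∘ lookup v) (toℕ j)

  canon : ∀ {m n i} → Echelon q n i → Tuple m n
  canon []                = λ ()
  canon (pivot {i = i} e) = basis i ∷ canon e
  canon (column v e)      = embed v ∷ canon e

  basis-supportedBelow : ∀ {m} i → SupportedBelow {m} (suc i) (basis i)
  basis-supportedBelow i j i<j = reflexive (δ-≢ (λ j≡i → ℕ.<-irrefl (≡.sym j≡i) i<j))

  embed-supportedBelow : ∀ {m i} (v : Vec (Fin q) i) → SupportedBelow {m} i (embed v)
  embed-supportedBelow v j i≤j = reflexive (padZero-≥ (enum ∘ lookup v) i≤j)

  canon-supportedBelow : ∀ {m n i} (e : Echelon q n i) j → SupportedBelow {m} i (canon e j)
  canon-supportedBelow (pivot e)    Fin.zero    = basis-supportedBelow _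
  canon-supportedBelow (pivot e)    (Fin.suc j) = λ k i<k → canon-supportedBelow e j k (ℕ.<⇒≤ i<k)
  canon-supportedBelow (column v e) Fin.zero    = embed-supportedBelow v
  canon-supportedBelow (column v e) (Fin.suc j) = canon-supportedBelow e j

  embed-inject≤ : ∀ {m i} (v : Vec (Fin q) i) (i≤m : i ℕ.≤ m) k → embed {m} v (inject≤ k i≤m) ≡ enum (lookup v k)
  embed-inject≤ v i≤m k = ≡.trans (≡.cong (padZero (enum ∘ lookup v)) (Fin.toℕ-inject≤ k i≤m)) (padZero-toℕ _ k)

  supportedBelow⇒embed : ∀ {m i} → i ℕ.≤ m → (w : Vector m) → SupportedBelow i w → ∃ λ v → w ≈ᵛ embed v
  supportedBelow⇒embed {i = i} i≤m w w-below = v , w≈v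
    where
    code : Fin i → Fin q
    code k = proj₁ (enum-surj (w (inject≤ k i≤m)))
    v : Vec (Fin q) i
    v = tabulate code
    w≈v : w ≈ᵛ embed v
    w≈v j with toℕ j ℕ.<? i
    ... | no  j≮i = trans (w-below j (ℕ.≮⇒≥ j≮i)) (sym (reflexive (padZero-≥ _ (ℕ.≮⇒≥ j≮i))))
    ... | yes j<i = begin
      w j                       ≡⟨ ≡.cong w j≡k ⟩
      w (inject≤ k i≤m)         ≈⟨ proj₂ (enum-surj _) ⟨
      enum (code k)             ≡⟨ ≡.cong enum (Vec.lookup∘tabulate code k) ⟨
      enum (lookup v k)         ≡⟨ embed-inject≤ v i≤m k ⟨
      embed v (inject≤ k i≤m)   ≡⟨ ≡.cong (embed v) j≡k ⟨
      embed v j                 ∎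
      where
      k : Fin i
      k = fromℕ< j<i
      j≡k : j ≡ inject≤ k i≤m
      j≡k = Fin.toℕ-injective (≡.sym (≡.trans (Fin.toℕ-inject≤ k i≤m) (Fin.toℕ-fromℕ< j<i)))

  embed-injective : ∀ {m i} → i ℕ.≤ m → (a b : Vec (Fin q) i) → embed {m} a ≈ᵛ embed b → a ≡ b
  embed-injective i≤m a b a≈b =
    ≡.trans (≡.sym (Vec.tabulate∘lookup a)) (≡.trans (Vec.tabulate-cong (λ k → enum-inj _ _ (entry k))) (Vec.tabulate∘lookup b))
    where
    entry : ∀ k → enum (lookup a k) ≈ enum (lookup b k)
    entry k = trans (reflexive (≡.sym (embed-inject≤ a i≤m k)))
                    (trans (a≈b (inject≤ k i≤m)) (reflexive (embed-inject≤ b i≤m k)))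

  basis≉embed : ∀ {m i} → i ℕ.< m → (v : Vec (Fin q) i) → ¬ basis {m} i ≈ᵛ embed v
  basis≉embed {i = i} i<m v eᵢ≈v = 0≉1 (begin
    0#               ≡⟨ padZero-≥ (enum ∘ lookup v) (ℕ.≤-reflexive (≡.sym ι≡i)) ⟨
    embed v ι        ≈⟨ eᵢ≈v ι ⟨
    δ (toℕ ι) i      ≡⟨ ≡.trans (≡.cong (λ r → δ r i) ι≡i) (δ-refl i) ⟩
    1#               ∎)
    where
    ι = fromℕ< i<m
    ι≡i = Fin.toℕ-fromℕ< i<m

  echelonOf : ∀ {m n} (x : Tuple m n) → Σ ℕ λ i → i ℕ.≤ m × Σ (Echelon q n i) λ e → AutOrbit x (canon e)
  echelonOf {n = zero} x = 0 , z≤n , [] , idᴬ , λ ()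
  echelonOf {n = suc n} x with echelonOf (λ k → x (Fin.suc k))
  ... | i , i≤m , e , φ , φx≈e with nonzeroFrom⊎supportedBelow i (⟦ to φ ⟧ (x Fin.zero))
  ...   | inj₁ (s , i≤s , φx₀[s]≉0) =
    let ψ , ψ-fixes , ψφx₀≈eᵢ = pivotAt i (⟦ to φ ⟧ (x Fin.zero)) s i≤s φx₀[s]≉0
    in suc i , ℕ.≤-<-trans i≤s (Fin.toℕ<n s) , pivot e , ψ ∘ᴬ φ ,
       λ { Fin.zero    → ψφx₀≈eᵢ
         ; (Fin.suc k) → ≋-trans (⟦⟧-cong (to ψ) (φx≈e k)) (ψ-fixes _ (canon-supportedBelow e k)) }
  ...   | inj₂ φx₀-below =
    let v , φx₀≈v = supportedBelow⇒embed i≤m _ φx₀-below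
    in i , i≤m , column v e , φ , λ { Fin.zero → φx₀≈v ; (Fin.suc k) → φx≈e k }

  fixes-embed : ∀ {m i} (L : LinearMap m) → (∀ r → r ℕ.< i → ⟦ L ⟧ (basis r) ≈ᵛ basis r) →
                (v : Vec (Fin q) i) → ⟦ L ⟧ (embed v) ≈ᵛ embed v
  fixes-embed L fixes v = fixes-basis⇒fixes-supportedBelow L _ fixes (embed v) (embed-supportedBelow v)

  echelon-unique : ∀ {m n i i′} (e : Echelon q n i) (e′ : Echelon q n i′) → i ℕ.≤ m → i′ ℕ.≤ m →
                   (φ : Automorphism m) → (∀ j → ⟦ to φ ⟧ (canon e j) ≈ᵛ canon e′ j) →
                   (i , e) ≡ (i′ , e′) × (∀ r → r ℕ.< i → ⟦ to φ ⟧ (basis r) ≈ᵛ basis r)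
  echelon-unique [] [] _ _ φ _ = ≡.refl , λ _ ()
  echelon-unique (pivot e) (pivot e′) i<m i′<m φ φe≈e′
    with echelon-unique e e′ (ℕ.<⇒≤ i<m) (ℕ.<⇒≤ i′<m) φ (φe≈e′ ∘ Fin.suc)
  ... | ≡.refl , fixes = ≡.refl , fixes′
    where
    fixes′ : ∀ r → r ℕ.< suc _ → ⟦ to φ ⟧ (basis r) ≈ᵛ basis r
    fixes′ r r<1+i with ℕ.m<1+n⇒m<n∨m≡n r<1+i
    ... | inj₁ r<i    = fixes r r<i
    ... | inj₂ ≡.refl = φe≈e′ Fin.zero
  echelon-unique (column a e) (column a′ e′) i≤m i′≤m φ φe≈e′
    with echelon-unique e e′ i≤m i′≤m φ (φe≈e′ ∘ Fin.suc)
  ... | ≡.refl , fixes with embed-injective i≤m a a′ (≋-trans (≋-sym (fixes-embed (to φ) fixes a)) (φe≈e′ Fin.zero))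
  ...   | ≡.refl = ≡.refl , fixes
  echelon-unique (pivot e) (column a′ e′) i<m i′≤m φ φe≈e′
    with echelon-unique e e′ (ℕ.<⇒≤ i<m) i′≤m φ (φe≈e′ ∘ Fin.suc)
  ... | ≡.refl , fixes =
    ⊥-elim (basis≉embed i<m a′ (to-injective φ (≋-trans (φe≈e′ Fin.zero) (≋-sym (fixes-embed (to φ) fixes a′)))))
  echelon-unique (column a e) (pivot e′) i≤m i′<m φ φe≈e′
    with echelon-unique e e′ i≤m (ℕ.<⇒≤ i′<m) φ (φe≈e′ ∘ Fin.suc)
  ... | ≡.refl , fixes =
    ⊥-elim (basis≉embed i′<m a (≋-trans (≋-sym (φe≈e′ Fin.zero)) (fixes-embed (to φ) fixes a)))

  normalForm : ∀ {m n} → Tuple m n → Echelon≤ q m n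
  normalForm x = let i , i≤m , e , _ = echelonOf x in i , s≤s i≤m , e

  canonical : ∀ {m n} → Echelon≤ q m n → Tuple m n
  canonical (_ , _ , e) = canon e

  normalForm-orbit : ∀ {m n} (x : Tuple m n) → AutOrbit x (canonical (normalForm x))
  normalForm-orbit x = proj₂ (proj₂ (proj₂ (echelonOf x)))

  canonical-injective : ∀ {m n} (E E′ : Echelon≤ q m n) → AutOrbit (canonical E) (canonical E′) → E ≡ E′
  canonical-injective (i , i<1+m , e) (i′ , i′<1+m , e′) (φ , φe≈e′)
    with echelon-unique e e′ (ℕ.≤-pred i<1+m) (ℕ.≤-pred i′<1+m) φ φe≈e′
  ... | ≡.refl , _ = ≡.cong (λ p → i , p , e) (ℕ.<-irrelevant i<1+m i′<1+m)

  normalForm-≡⇔AutOrbit : ∀ {m n} (x y : Tuple m n) → normalForm x ≡ normalForm y ⇔ AutOrbit x y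
  normalForm-≡⇔AutOrbit x y = mk⇔
    (λ nx≡ny → AutOrbit-trans (normalForm-orbit x)
                 (≡.subst (λ E → AutOrbit (canonical E) y) (≡.sym nx≡ny) (AutOrbit-sym (normalForm-orbit y))))
    (λ x∼y → canonical-injective _ _
               (AutOrbit-trans (AutOrbit-sym (normalForm-orbit x)) (AutOrbit-trans x∼y (normalForm-orbit y))))

  numOrbits : ∀ {m n k} → Echelon≤ q m n ↔ Fin k → NumOrbits m n k
  numOrbits E↔Fin = encode ∘ normalForm , surjective , kernel
    where
    open Inverse E↔Fin renaming (to to encode; from to decode)
    surjective : ∀ o → ∃ λ x → encode (normalForm x) ≡ o
    surjective o = canonical (decode o) ,
      ≡.trans (≡.cong encode (canonical-injective _ _ (AutOrbit-sym (normalForm-orbit (canonical (decode o))))))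
              (strictlyInverseˡ o)
    kernel : ∀ x y → encode (normalForm x) ≡ encode (normalForm y) ⇔ SameOrbit x y
    kernel x y = mk⇔
      (λ eq → Equivalence.from SameOrbit⇔AutOrbit (Equivalence.to (normalForm-≡⇔AutOrbit x y) (encode-injective eq)))
      (λ x∼y → ≡.cong encode (Equivalence.from (normalForm-≡⇔AutOrbit x y) (Equivalence.to SameOrbit⇔AutOrbit x∼y)))
      where
      encode-injective : ∀ {E E′} → encode E ≡ encode E′ → E ≡ E′
      encode-injective {E} {E′} eq = ≡.trans (≡.sym (strictlyInverseʳ E)) (≡.trans (≡.cong decode eq) (strictlyInverseʳ E′))

theorem8 : ∀ {c ℓ : Level} (q : ℕ) (F : FiniteField c ℓ q) (m : ℕ) → m ≥ 1 →
           ∀ (n : ℕ) → LinAlg.NumOrbits (FiniteField.ring F) m n (rhsSeries q m n)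
theorem8 q F m _ n = Orbits.numOrbits F (Echelon≤↔Fin q m n)
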